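{- Let $n\geq 3$ and let $G$ be an edge-colored complete 3-partite 3-graph $K^{(3)}_{n,n,n}$ with partite sets $V_1,V_2,V_3$, containing no rainbow copy of $\mathcal{T}$, with $k=|C(G)|\geq 3$. Then at least one of the following holds: (i) for some $\ell\in[3]$, the set $V_\ell$ can be partitioned into $k$ parts $V_{\ell,1},\ldots,V_{\ell,k}$ such that (with colors numbered $1,\ldots,k$) for each $i\in[k]$ all edges containing a vertex of $V_{\ell,i}$ have color $i$; (ii) after renumbering the colors as $1,\ldots,k$ if necessary, for every $\ell\in[3]$ the set $V_\ell$ can be partitioned into $k-1$ parts $V_{\ell,2},\ldots,V_{\ell,k}$ such that for every $i\in\{2,\ldots,k\}$ all edges contained in $V_{1,i}\cup V_{2,i}\cup V_{3,i}$ have color $1$ or $i$, and all remaining edges have color $1$.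
   Context: $K^{(3)}_{n,n,n}$ with partite sets $V_1,V_2,V_3$ (disjoint, each of size $n$) is the 3-graph whose edges are all sets $\{x,y,z\}$ with $x\in V_1,y\in V_2,z\in V_3$. An edge-coloring is any map $c$ from edges to colors; $C(G)$ is the set of colors used; a copy is rainbow if its edges have pairwise distinct colors. The tight path $\mathcal{T}$ is the 3-graph with edges $\{v_1v_2v_3,v_2v_3v_4,v_3v_4v_5\}$. -}

module Defs where

open import Data.Nat using (ℕ)
open import Data.Fin using (Fin; zero; suc)
open import Data.Product using (Σ; _×_; _,_; ∃)
open import Data.Sum using (_⊎_)
open import Relation.Nullary using (¬_)
open import Relation.Binary.PropositionalEquality using (_≡_; _≢_)

-- Vertices of K^(3)_{n,n,n}: (ℓ , i) is the i-th vertex of the partite set V_ℓ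
-- (ℓ ∈ Fin 3 encodes V_1, V_2, V_3).
Vertex : ℕ → Set
Vertex n = Fin 3 × Fin n

-- An edge-coloring of K^(3)_{n,n,n} with color set Fin k:
-- c x y z is the color of the edge {x,y,z}, x ∈ V_1, y ∈ V_2, z ∈ V_3.
Coloring : ℕ → ℕ → Set
Coloring n k = Fin n → Fin n → Fin n → Fin k

-- C(G) = Fin k exactly, i.e. every color of Fin k is used (so |C(G)| = k).
UsesAllColors : ∀ {n k} → Coloring n k → Set
UsesAllColors {n} {k} c = (i : Fin k) → ∃ λ x → ∃ λ y → ∃ λ z → c x y z ≡ i

-- EdgeCol c u v w a : the (unordered) triple {u,v,w} is an edge of
-- K^(3)_{n,n,n} (one vertex in each partite set, in any order) and it has color a.
data EdgeCol {n k : ℕ} (c : Coloring n k) :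
       Vertex n → Vertex n → Vertex n → Fin k → Set where
  e123 : ∀ x y z → EdgeCol c (zero , x) (suc zero , y) (suc (suc zero) , z) (c x y z)
  e132 : ∀ x y z → EdgeCol c (zero , x) (suc (suc zero) , z) (suc zero , y) (c x y z)
  e213 : ∀ x y z → EdgeCol c (suc zero , y) (zero , x) (suc (suc zero) , z) (c x y z)
  e231 : ∀ x y z → EdgeCol c (suc zero , y) (suc (suc zero) , z) (zero , x) (c x y z)
  e312 : ∀ x y z → EdgeCol c (suc (suc zero) , z) (zero , x) (suc zero , y) (c x y z)
  e321 : ∀ x y z → EdgeCol c (suc (suc zero) , z) (suc zero , y) (zero , x) (c x y z)

Distinct5 : ∀ {n} → Vertex n → Vertex n → Vertex n → Vertex n → Vertex n → Set
Distinct5 v1 v2 v3 v4 v5 =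
  v1 ≢ v2 × v1 ≢ v3 × v1 ≢ v4 × v1 ≢ v5 ×
  v2 ≢ v3 × v2 ≢ v4 × v2 ≢ v5 ×
  v3 ≢ v4 × v3 ≢ v5 ×
  v4 ≢ v5

-- A rainbow copy of the tight path T = {v1v2v3, v2v3v4, v3v4v5} in G:
-- five distinct vertices, all three triples are edges of G, with pairwise
-- distinct colors.
RainbowTightPath : ∀ {n k} → Coloring n k → Set
RainbowTightPath {n} {k} c =
  Σ (Vertex n) λ v1 → Σ (Vertex n) λ v2 → Σ (Vertex n) λ v3 →
  Σ (Vertex n) λ v4 → Σ (Vertex n) λ v5 →
  Σ (Fin k) λ a → Σ (Fin k) λ b → Σ (Fin k) λ d →
    Distinct5 v1 v2 v3 v4 v5 ×
    EdgeCol c v1 v2 v3 a × EdgeCol c v2 v3 v4 b × EdgeCol c v3 v4 v5 d ×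
    a ≢ b × a ≢ d × b ≢ d

coord : ∀ {n} → Fin 3 → Fin n → Fin n → Fin n → Fin n
coord zero x y z = x
coord (suc zero) x y z = y
coord (suc (suc zero)) x y z = z

-- Conclusion (i): for some ℓ, V_ℓ is partitioned into parts V_{ℓ,i} (i ∈ Fin k,
-- part of v is p v) such that every edge containing a vertex of V_{ℓ,i}
-- has color i.
StructureI : ∀ {n k} → Coloring n k → Set
StructureI {n} {k} c =
  Σ (Fin 3) λ ℓ → Σ (Fin n → Fin k) λ p →
    ∀ x y z → c x y z ≡ p (coord ℓ x y z)

-- Conclusion (ii): there is a distinguished color `one` (color 1 after
-- renumbering) and, for each ℓ, a partition of V_ℓ into parts indexed by the
-- other colors (p ℓ v ≢ one), such that every edge inside
-- V_{1,i} ∪ V_{2,i} ∪ V_{3,i} has color one or i, and every other edge has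
-- color one.
StructureII : ∀ {n k} → Coloring n k → Set
StructureII {n} {k} c =
  Σ (Fin k) λ one → Σ (Fin 3 → Fin n → Fin k) λ p →
    (∀ ℓ v → p ℓ v ≢ one) ×
    (∀ x y z →
      ((p zero x ≡ p (suc zero) y × p (suc zero) y ≡ p (suc (suc zero)) z) →
         (c x y z ≡ one ⊎ c x y z ≡ p zero x)) ×
      (¬ (p zero x ≡ p (suc zero) y × p (suc zero) y ≡ p (suc (suc zero)) z) →
         c x y z ≡ one))

-- If e′ and e″ each share two vertices with an edge e, and differ from e in
-- different parts, then e′ e e″ is a tight path, so the three colours are never
-- pairwise distinct.  If some line (the edges through two fixed vertices)
-- shows three colours, this forces the colour of every edge to depend only on
-- its vertex in the remaining part: conclusion (i).  Otherwise every line, and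
-- then every plane (the edges through one fixed vertex), shows at most two
-- colours.  From three edges of distinct colours one finds an edge E of colour
-- o whose planes in two different directions contain two further distinct
-- colours; the line where these planes meet is then coloured o throughout,
-- which leaves no plane room for two colours other than o.  The colour other
-- than o on the planes through a vertex gives the partition of conclusion (ii),
-- with o as colour 1.
module Submission where

open import Defs
open import Data.Nat using (ℕ; _≥_; s≤s)
open import Data.Fin using (Fin; zero; suc; _≟_)
open import Data.Fin.Properties using (any?)
open import Data.Product using (Σ; _×_; _,_; ∃; proj₁; proj₂; uncurry)
open import Data.Sum using (_⊎_; inj₁; inj₂)
import Data.Sum as Sum
open import Data.Empty using (⊥; ⊥-elim)
open import Function using (_∘_; flip)
open import Relation.Nullary using (¬_; Dec; yes; no)
open import Relation.Nullary.Decidable using (¬?; _×-dec_)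
open import Relation.Binary.Definitions using (DecidableEquality)
open import Relation.Binary.PropositionalEquality
  using (_≡_; _≢_; refl; sym; trans; ≢-sym)

module _ {C : Set} where

  Rainbow₃ : C → C → C → Set
  Rainbow₃ a b d = a ≢ b × a ≢ d × b ≢ d

  rainbow₃-swap₂₃ : ∀ {a b d} → Rainbow₃ a b d → Rainbow₃ a d b
  rainbow₃-swap₂₃ (a≢b , a≢d , b≢d) = a≢d , a≢b , ≢-sym b≢d

  rainbow₃-cong : ∀ {a a′ b b′ d d′} → a ≡ a′ → b ≡ b′ → d ≡ d′ →
                  Rainbow₃ a b d → Rainbow₃ a′ b′ d′
  rainbow₃-cong refl refl refl r = r

  rainbow₃-pigeonhole : ∀ {a b a₁ a₂ a₃} → Rainbow₃ a₁ a₂ a₃ →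
    a₁ ≡ a ⊎ a₁ ≡ b → a₂ ≡ a ⊎ a₂ ≡ b → a₃ ≡ a ⊎ a₃ ≡ b → ⊥
  rainbow₃-pigeonhole (a₁≢a₂ , _ , _) (inj₁ refl) (inj₁ refl) _ = a₁≢a₂ refl
  rainbow₃-pigeonhole (a₁≢a₂ , _ , _) (inj₂ refl) (inj₂ refl) _ = a₁≢a₂ refl
  rainbow₃-pigeonhole (_ , a₁≢a₃ , _) (inj₁ refl) _ (inj₁ refl) = a₁≢a₃ refl
  rainbow₃-pigeonhole (_ , a₁≢a₃ , _) (inj₂ refl) _ (inj₂ refl) = a₁≢a₃ refl
  rainbow₃-pigeonhole (_ , _ , a₂≢a₃) _ (inj₁ refl) (inj₁ refl) = a₂≢a₃ refl
  rainbow₃-pigeonhole (_ , _ , a₂≢a₃) _ (inj₂ refl) (inj₂ refl) = a₂≢a₃ refl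

  ≡-of-two-pairs : ∀ {a b d t : C} → t ≡ a ⊎ t ≡ b → t ≡ a ⊎ t ≡ d → b ≢ d → t ≡ a
  ≡-of-two-pairs (inj₁ t≡a) _ _ = t≡a
  ≡-of-two-pairs (inj₂ _) (inj₁ t≡a) _ = t≡a
  ≡-of-two-pairs (inj₂ t≡b) (inj₂ t≡d) b≢d = ⊥-elim (b≢d (trans (sym t≡b) t≡d))

  AtMostTwoColours : {A : Set} → (A → C) → Set
  AtMostTwoColours f = ∀ a b d → ¬ Rainbow₃ (f a) (f b) (f d)

  OneColourBesides : {A : Set} → C → (A → C) → Set
  OneColourBesides o f = ∀ a b → f a ≢ o → f b ≢ o → f a ≡ f b

module WithDecidableColours {C : Set} (_≟_ : DecidableEquality C) where

  rainbow₃? : (a b d : C) → Dec (Rainbow₃ a b d)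
  rainbow₃? a b d = ¬? (a ≟ b) ×-dec ¬? (a ≟ d) ×-dec ¬? (b ≟ d)

  ¬rainbow₃⇒∈ : ∀ {a b t} → a ≢ b → ¬ Rainbow₃ a b t → t ≡ a ⊎ t ≡ b
  ¬rainbow₃⇒∈ {a} {b} {t} a≢b h with t ≟ a | t ≟ b
  ... | yes t≡a | _       = inj₁ t≡a
  ... | no _    | yes t≡b = inj₂ t≡b
  ... | no t≢a  | no t≢b  = ⊥-elim (h (a≢b , ≢-sym t≢a , ≢-sym t≢b))

  ≡-pinned-by-rainbow₃ : ∀ {a t a₁ a₂ a₃} → Rainbow₃ a₁ a₂ a₃ →
    ¬ Rainbow₃ a a₁ t → ¬ Rainbow₃ a a₂ t → ¬ Rainbow₃ a a₃ t → t ≡ a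
  ≡-pinned-by-rainbow₃ {a} {t} r h₁ h₂ h₃ with t ≟ a
  ... | yes t≡a = t≡a
  ... | no t≢a  = ⊥-elim (rainbow₃-pigeonhole r (∈a,t h₁) (∈a,t h₂) (∈a,t h₃))
    where
    ∈a,t : ∀ {b} → ¬ Rainbow₃ a b t → b ≡ a ⊎ b ≡ t
    ∈a,t h = ¬rainbow₃⇒∈ (≢-sym t≢a) (h ∘ rainbow₃-swap₂₃)

  module _ {A : Set} {f : A → C} (two : AtMostTwoColours f) where

    atMostTwo⇒∈ : ∀ a b → f a ≢ f b → ∀ t → f t ≡ f a ⊎ f t ≡ f b
    atMostTwo⇒∈ a b fa≢fb t = ¬rainbow₃⇒∈ fa≢fb (two a b t)

    atMostTwo∋⇒oneColourBesides : ∀ {o} a → f a ≡ o → OneColourBesides o f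
    atMostTwo∋⇒oneColourBesides a fa≡o b b′ fb≢o fb′≢o with f b ≟ f b′
    ... | yes fb≡fb′ = fb≡fb′
    ... | no fb≢fb′ = ⊥-elim (two b b′ a
      (fb≢fb′ , (λ e → fb≢o (trans e fa≡o)) , (λ e → fb′≢o (trans e fa≡o))))

  -- t₁, t₂, t are the colours at (u,s), (u,s′), (u,v) of a grid whose
  -- cells (r,s), (r,s′) have colours a ≢ b; each hypothesis is a corner or a row.
  twoColours-spread : ∀ {a b t₁ t₂ t} → a ≢ b →
    ¬ Rainbow₃ a t₁ b → ¬ Rainbow₃ b t₂ a →
    ¬ Rainbow₃ t₁ a t → ¬ Rainbow₃ t₁ t₂ t → ¬ Rainbow₃ t₂ b t → t ≡ a ⊎ t ≡ b
  twoColours-spread a≢b h₁ h₂ h₃ h₄ h₅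
    with ¬rainbow₃⇒∈ a≢b (h₁ ∘ rainbow₃-swap₂₃)
       | ¬rainbow₃⇒∈ (≢-sym a≢b) (h₂ ∘ rainbow₃-swap₂₃)
  ... | inj₂ refl | _         = Sum.swap (¬rainbow₃⇒∈ (≢-sym a≢b) h₃)
  ... | inj₁ refl | inj₁ refl = ¬rainbow₃⇒∈ a≢b h₄
  ... | inj₁ refl | inj₂ refl = ¬rainbow₃⇒∈ a≢b h₅

  rowPair-spans : ∀ {R S : Set} (M : R → S → C) →
    (∀ r s r′ s′ → ¬ Rainbow₃ (M r s) (M r′ s) (M r s′)) →
    (∀ r → AtMostTwoColours (M r)) →
    ∀ {r s s′} → M r s ≢ M r s′ → ∀ u v → M u v ≡ M r s ⊎ M u v ≡ M r s′
  rowPair-spans M corner rows {r} {s} {s′} ne u v = twoColours-spread ne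
    (corner r s u s′) (corner r s′ u s) (corner u s r v) (rows u s s′ v) (corner u s′ r v)

  atMostTwoColours-grid : ∀ {R S : Set} (M : R → S → C) →
    (∀ r s r′ s′ → ¬ Rainbow₃ (M r s) (M r′ s) (M r s′)) →
    (∀ r → AtMostTwoColours (M r)) → (∀ s → AtMostTwoColours (λ r → M r s)) →
    AtMostTwoColours (uncurry M)
  atMostTwoColours-grid M corner rows cols (r , s) (r′ , s′) (u , v) rb with M r s ≟ M r s′
  ... | no ne = rainbow₃-pigeonhole rb (inj₁ refl)
        (rowPair-spans M corner rows ne r′ s′) (rowPair-spans M corner rows ne u v)
  ... | yes e = rainbow₃-pigeonhole rb (inj₁ e) (inj₂ refl)
        (rowPair-spans (flip M) (λ s r s′ r′ → corner r s r′ s′ ∘ rainbow₃-swap₂₃) cols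
          (λ e′ → proj₁ rb (trans e e′)) v u)

  representative : ∀ {m m′ o d} (f : Fin m → Fin m′ → C) → d ≢ o →
    OneColourBesides o (uncurry f) →
    Σ C λ col → col ≢ o × (∀ a b → f a b ≢ o → f a b ≡ col)
  representative {o = o} {d} f d≢o one with any? (λ a → any? λ b → ¬? (f a b ≟ o))
  ... | yes (a , b , fab≢o) = f a b , fab≢o , λ a′ b′ ne → one (a′ , b′) (a , b) ne fab≢o
  ... | no none = d , d≢o , λ a b ne → ⊥-elim (none (a , b , ne))

  another-colour : ∀ {a b} → a ≢ b → (o : C) → Σ C (_≢ o)
  another-colour {a} {b} a≢b o with a ≟ o
  ... | yes a≡o = b , λ b≡o → a≢b (trans a≡o (sym b≡o))
  ... | no a≢o = a , a≢o

-- orient c ℓ is c with the coordinate in V_ℓ moved to the front (the other two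
-- keep their order), so orient c ℓ v colours the plane of edges through (ℓ , v).
orient : ∀ {n k} → Coloring n k → Fin 3 → Coloring n k
orient c zero x y z = c x y z
orient c (suc zero) y x z = c x y z
orient c (suc (suc zero)) z x y = c x y z

module _ {n k : ℕ} (c : Coloring n k) (noRainbow : ¬ RainbowTightPath c) where

  corner₁₂ : ∀ x y z x′ y′ → ¬ Rainbow₃ (c x y z) (c x′ y z) (c x y′ z)
  corner₁₂ x y z x′ y′ (e≢e′ , e≢e″ , e′≢e″) = noRainbow
    ( (zero , x′) , (suc zero , y) , (suc (suc zero) , z) , (zero , x) , (suc zero , y′)
    , _ , _ , _
    , ( (λ ()) , (λ ()) , (λ { refl → e≢e′ refl }) , (λ ())
      , (λ ()) , (λ ()) , (λ { refl → e≢e″ refl })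
      , (λ ()) , (λ ())
      , (λ ()) )
    , e123 x′ y z , e231 x y z , e312 x y′ z
    , ≢-sym e≢e′ , e′≢e″ , e≢e″ )

  corner₁₃ : ∀ x y z x′ z′ → ¬ Rainbow₃ (c x y z) (c x′ y z) (c x y z′)
  corner₁₃ x y z x′ z′ (e≢e′ , e≢e″ , e′≢e″) = noRainbow
    ( (zero , x′) , (suc (suc zero) , z) , (suc zero , y) , (zero , x) , (suc (suc zero) , z′)
    , _ , _ , _
    , ( (λ ()) , (λ ()) , (λ { refl → e≢e′ refl }) , (λ ())
      , (λ ()) , (λ ()) , (λ { refl → e≢e″ refl })
      , (λ ()) , (λ ())
      , (λ ()) )
    , e132 x′ y z , e321 x y z , e213 x y z′
    , ≢-sym e≢e′ , e′≢e″ , e≢e″ )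

  corner₂₃ : ∀ x y z y′ z′ → ¬ Rainbow₃ (c x y z) (c x y′ z) (c x y z′)
  corner₂₃ x y z y′ z′ (e≢e′ , e≢e″ , e′≢e″) = noRainbow
    ( (suc zero , y′) , (suc (suc zero) , z) , (zero , x) , (suc zero , y) , (suc (suc zero) , z′)
    , _ , _ , _
    , ( (λ ()) , (λ ()) , (λ { refl → e≢e′ refl }) , (λ ())
      , (λ ()) , (λ ()) , (λ { refl → e≢e″ refl })
      , (λ ()) , (λ ())
      , (λ ()) )
    , e231 x y′ z , e312 x y z , e123 x y z′
    , ≢-sym e≢e′ , e′≢e″ , e≢e″ )

module _ {n k : ℕ} where
  open WithDecidableColours (_≟_ {k})

  module _ {c : Coloring n k}
           (h₁₂ : ∀ x y z x′ y′ → ¬ Rainbow₃ (c x y z) (c x′ y z) (c x y′ z))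
           (h₁₃ : ∀ x y z x′ z′ → ¬ Rainbow₃ (c x y z) (c x′ y z) (c x y z′)) where

    rainbowLine-fixes-y : ∀ {x₁ x₂ x₃ y z} → Rainbow₃ (c x₁ y z) (c x₂ y z) (c x₃ y z) →
                          ∀ x y′ → c x y′ z ≡ c x y z
    rainbowLine-fixes-y {x₁} {x₂} {x₃} {y} {z} r x y′ =
      ≡-pinned-by-rainbow₃ r (h₁₂ x y z x₁ y′) (h₁₂ x y z x₂ y′) (h₁₂ x y z x₃ y′)

    rainbowLine-fixes-z : ∀ {x₁ x₂ x₃ y z} → Rainbow₃ (c x₁ y z) (c x₂ y z) (c x₃ y z) →
                          ∀ x z′ → c x y z′ ≡ c x y z
    rainbowLine-fixes-z {x₁} {x₂} {x₃} {y} {z} r x z′ =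
      ≡-pinned-by-rainbow₃ r (h₁₃ x y z x₁ z′) (h₁₃ x y z x₂ z′) (h₁₃ x y z x₃ z′)

    rainbowLine⇒dependsOnFirst : ∀ {x₁ x₂ x₃ y₀ z₀} →
      Rainbow₃ (c x₁ y₀ z₀) (c x₂ y₀ z₀) (c x₃ y₀ z₀) → ∀ x y z → c x y z ≡ c x y₀ z₀
    rainbowLine⇒dependsOnFirst {x₁} {x₂} {x₃} {z₀ = z₀} r x y z =
      trans (rainbowLine-fixes-z r′ x z) (rainbowLine-fixes-y r x y)
      where
      r′ : Rainbow₃ (c x₁ y z₀) (c x₂ y z₀) (c x₃ y z₀)
      r′ = rainbow₃-cong (sym (rainbowLine-fixes-y r x₁ y)) (sym (rainbowLine-fixes-y r x₂ y))
                         (sym (rainbowLine-fixes-y r x₃ y)) r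

    dependsOnFirst⊎linesAtMostTwo : (Σ (Fin n → Fin k) λ p → ∀ x y z → c x y z ≡ p x)
                                  ⊎ (∀ y z → AtMostTwoColours (λ x → c x y z))
    dependsOnFirst⊎linesAtMostTwo
      with any? (λ y → any? λ z → any? λ x₁ → any? λ x₂ → any? λ x₃ →
                   rainbow₃? (c x₁ y z) (c x₂ y z) (c x₃ y z))
    ... | yes (_ , _ , _ , _ , _ , r) = inj₁ (_ , rainbowLine⇒dependsOnFirst r)
    ... | no none = inj₂ λ y z x₁ x₂ x₃ r → none (y , z , x₁ , x₂ , x₃ , r)

  structureI⊎linesAtMostTwo : (c : Coloring n k) → ¬ RainbowTightPath c →
    StructureI c ⊎ (∀ ℓ a b → AtMostTwoColours (λ v → orient c ℓ v a b))
  structureI⊎linesAtMostTwo c noRainbow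
    with dependsOnFirst⊎linesAtMostTwo {c = orient c zero}
           (corner₁₂ c noRainbow) (corner₁₃ c noRainbow)
       | dependsOnFirst⊎linesAtMostTwo {c = orient c (suc zero)}
           (λ y x z y′ x′ → corner₁₂ c noRainbow x y z x′ y′ ∘ rainbow₃-swap₂₃)
           (λ y x z y′ z′ → corner₂₃ c noRainbow x y z y′ z′)
       | dependsOnFirst⊎linesAtMostTwo {c = orient c (suc (suc zero))}
           (λ z x y z′ x′ → corner₁₃ c noRainbow x y z x′ z′ ∘ rainbow₃-swap₂₃)
           (λ z x y z′ y′ → corner₂₃ c noRainbow x y z y′ z′ ∘ rainbow₃-swap₂₃)
  ... | inj₁ (p , h) | _ | _ = inj₁ (zero , p , h)
  ... | _ | inj₁ (p , h) | _ = inj₁ (suc zero , p , λ x y z → h y x z)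
  ... | _ | _ | inj₁ (p , h) = inj₁ (suc (suc zero) , p , λ x y z → h z x y)
  ... | inj₂ lines₀ | inj₂ lines₁ | inj₂ lines₂ =
    inj₂ λ { zero → lines₀ ; (suc zero) → lines₁ ; (suc (suc zero)) → lines₂ }

  planesAtMostTwo : (c : Coloring n k) → ¬ RainbowTightPath c →
    (∀ ℓ a b → AtMostTwoColours (λ v → orient c ℓ v a b)) →
    ∀ ℓ v → AtMostTwoColours (uncurry (orient c ℓ v))
  planesAtMostTwo c noRainbow lines zero x =
    atMostTwoColours-grid (orient c zero x) (corner₂₃ c noRainbow x)
      (lines (suc (suc zero)) x) (lines (suc zero) x)
  planesAtMostTwo c noRainbow lines (suc zero) y =
    atMostTwoColours-grid (orient c (suc zero) y) (λ x z → corner₁₃ c noRainbow x y z)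
      (λ x → lines (suc (suc zero)) x y) (lines zero y)
  planesAtMostTwo c noRainbow lines (suc (suc zero)) z =
    atMostTwoColours-grid (orient c (suc (suc zero)) z) (λ x y → corner₁₂ c noRainbow x y z)
      (λ x → lines (suc zero) x z) (λ y → lines zero y z)

  Background : Coloring n k → Fin k → Set
  Background c o = ∀ ℓ v → OneColourBesides o (uncurry (orient c ℓ v))

  module _ {c : Coloring n k} (planes : ∀ ℓ v → AtMostTwoColours (uncurry (orient c ℓ v))) where

    centre⇒background : ∀ {x₀ y₀ z₀ y₁ z₁ x₂ z₂} →
      Rainbow₃ (c x₀ y₀ z₀) (c x₀ y₁ z₁) (c x₂ y₀ z₂) → Background c (c x₀ y₀ z₀)
    centre⇒background {x₀} {y₀} {z₀} {y₁} {z₁} {x₂} {z₂} (o≢b , o≢d , b≢d) = background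
      where
      inX : ∀ y z → c x₀ y z ≡ c x₀ y₀ z₀ ⊎ c x₀ y z ≡ c x₀ y₁ z₁
      inX y z = atMostTwo⇒∈ (planes zero x₀) (y₀ , z₀) (y₁ , z₁) o≢b (y , z)
      inY : ∀ x z → c x y₀ z ≡ c x₀ y₀ z₀ ⊎ c x y₀ z ≡ c x₂ y₀ z₂
      inY x z = atMostTwo⇒∈ (planes (suc zero) y₀) (x₀ , z₀) (x₂ , z₂) o≢d (x , z)
      axis : ∀ z → c x₀ y₀ z ≡ c x₀ y₀ z₀
      axis z = ≡-of-two-pairs (inX y₀ z) (inY x₀ z) b≢d
      -- The edge (x , y₀ , z₁) has colour o or d; if d, the z₁-plane would show b, o, d.
      background : Background c (c x₀ y₀ z₀)
      background zero x with inY x z₁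
      ... | inj₁ e = atMostTwo∋⇒oneColourBesides (planes zero x) (y₀ , z₁) e
      ... | inj₂ e = ⊥-elim (planes (suc (suc zero)) z₁ (x₀ , y₁) (x₀ , y₀) (x , y₀)
                       (rainbow₃-cong refl (sym (axis z₁)) (sym e) (≢-sym o≢b , b≢d , o≢d)))
      background (suc zero) y with inX y z₂
      ... | inj₁ e = atMostTwo∋⇒oneColourBesides (planes (suc zero) y) (x₀ , z₂) e
      ... | inj₂ e = ⊥-elim (planes (suc (suc zero)) z₂ (x₂ , y₀) (x₀ , y₀) (x₀ , y)
                       (rainbow₃-cong refl (sym (axis z₂)) (sym e) (≢-sym o≢d , ≢-sym b≢d , o≢b)))
      background (suc (suc zero)) z =
        atMostTwo∋⇒oneColourBesides (planes (suc (suc zero)) z) (x₀ , y₀) (axis z)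

    -- With A, B, C of colours α, β, γ, the edge (xA , yC , zB) of colour δ meets
    -- A, C, B in its x-, y-, z-plane and serves as centre unless δ is α or γ.
    -- In those cases the centre is an edge lying in two planes that show δ
    -- together with two different colours, so that its colour is δ as well.
    background-exists : ∀ {xA yA zA xB yB zB xC yC zC} →
      Rainbow₃ (c xA yA zA) (c xB yB zB) (c xC yC zC) → ∃ (Background c)
    background-exists {xA} {yA} {zA} {xB} {yB} {zB} {xC} {yC} {zC} (α≢β , α≢γ , β≢γ)
      with c xA yC zB ≟ c xA yA zA | c xA yC zB ≟ c xC yC zC
    ... | no δ≢α | no δ≢γ = _ , centre⇒background (δ≢α , δ≢γ , α≢γ)
    ... | yes δ≡α | _ = _ , centre⇒background {xB} {yC} {zB} {yB} {zB} {xC} {zC}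
                             (rainbow₃-cong (sym (trans ε≡δ δ≡α)) refl refl (α≢β , α≢γ , β≢γ))
      where
      ε≡δ : c xB yC zB ≡ c xA yC zB
      ε≡δ = ≡-of-two-pairs
        (atMostTwo⇒∈ (planes (suc (suc zero)) zB) (xA , yC) (xB , yB)
          (λ e → α≢β (trans (sym δ≡α) e)) (xB , yC))
        (atMostTwo⇒∈ (planes (suc zero) yC) (xA , zB) (xC , zC)
          (λ e → α≢γ (trans (sym δ≡α) e)) (xB , zB))
        β≢γ
    ... | no _ | yes δ≡γ = _ , centre⇒background {xA} {yB} {zB} {yA} {zA} {xB} {zB}
                             (rainbow₃-cong (sym (trans ε≡δ δ≡γ)) refl refl
                               (≢-sym α≢γ , ≢-sym β≢γ , α≢β))
      where
      ε≡δ : c xA yB zB ≡ c xA yC zB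
      ε≡δ = ≡-of-two-pairs
        (atMostTwo⇒∈ (planes zero xA) (yC , zB) (yA , zA)
          (λ e → α≢γ (trans (sym e) δ≡γ)) (yB , zB))
        (atMostTwo⇒∈ (planes (suc (suc zero)) zB) (xA , yC) (xB , yB)
          (λ e → β≢γ (trans (sym e) δ≡γ)) (xA , yB))
        α≢β

    background⇒structureII : ∀ {o d} → d ≢ o → Background c o → StructureII c
    background⇒structureII {o} d≢o background = o , p , p≢o , classify
      where
      part : ∀ ℓ v → Σ (Fin k) λ col →
             col ≢ o × (∀ a b → orient c ℓ v a b ≢ o → orient c ℓ v a b ≡ col)
      part ℓ v = representative (orient c ℓ v) d≢o (background ℓ v)
      p : Fin 3 → Fin n → Fin k
      p ℓ v = proj₁ (part ℓ v)
      p≢o : ∀ ℓ v → p ℓ v ≢ o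
      p≢o ℓ v = proj₁ (proj₂ (part ℓ v))
      classify : ∀ x y z →
        ((p zero x ≡ p (suc zero) y × p (suc zero) y ≡ p (suc (suc zero)) z) →
           (c x y z ≡ o ⊎ c x y z ≡ p zero x)) ×
        (¬ (p zero x ≡ p (suc zero) y × p (suc zero) y ≡ p (suc (suc zero)) z) →
           c x y z ≡ o)
      classify x y z with c x y z ≟ o
      ... | yes e = (λ _ → inj₁ e) , (λ _ → e)
      ... | no ne = (λ _ → inj₂ e₀)
                  , (λ differ → ⊥-elim (differ (trans (sym e₀) e₁ , trans (sym e₁) e₂)))
        where
        e₀ : c x y z ≡ p zero x
        e₀ = proj₂ (proj₂ (part zero x)) y z ne
        e₁ : c x y z ≡ p (suc zero) y
        e₁ = proj₂ (proj₂ (part (suc zero) y)) x z ne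
        e₂ : c x y z ≡ p (suc (suc zero)) z
        e₂ = proj₂ (proj₂ (part (suc (suc zero)) z)) x y ne

    structureII : ∀ {xA yA zA xB yB zB xC yC zC} →
      Rainbow₃ (c xA yA zA) (c xB yB zB) (c xC yC zC) → StructureII c
    structureII r with background-exists r
    ... | o , background = background⇒structureII (proj₂ (another-colour (proj₁ r) o)) background

theorem1p13 : (n k : ℕ) → n ≥ 3 → k ≥ 3 →
    (c : Coloring n k) → UsesAllColors c →
    ¬ RainbowTightPath c →
    StructureI c ⊎ StructureII c
theorem1p13 n _ _ (s≤s (s≤s (s≤s _))) c usesAll noRainbow
  with structureI⊎linesAtMostTwo c noRainbow
... | inj₁ structureI = inj₁ structureI
... | inj₂ lines with usesAll zero | usesAll (suc zero) | usesAll (suc (suc zero))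
...   | _ , _ , _ , c≡0 | _ , _ , _ , c≡1 | _ , _ , _ , c≡2 =
  inj₂ (structureII (planesAtMostTwo c noRainbow lines)
         (rainbow₃-cong (sym c≡0) (sym c≡1) (sym c≡2) ((λ ()) , (λ ()) , (λ ()))))
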